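{- A morphism $f:P\to Q$ of reflexive presentations has the right lifting property with respect to every morphism of $\mathcal{I}$ (i.e. is a trivial fibration) if and only if (1) its underlying function $f:P_1\to Q_1$ is surjective, and (2) for all $u,v\in P_1^*$, $f^*(u)\to f^*(v)\in Q_2$ implies $u\to v\in P_2$.
   Context: $\mathbf{rPres}$ is the category of reflexive presentations of monoids (generators $P_1$, relations $P_2\subseteq P_1^*\times P_1^*$ containing $u\to u$ for every $u\in P_1^*$; a morphism is a function on generators whose extension $f^*$ to words sends relations to relations). Let $G$ be the presentation with one generator and no relation, $G^n$ the one with generators $a_1,\dots,a_n$ and no relation, and $R^{m,n}$ the one with generators $a_1,\dots,a_{m+n}$ and relation $a_1\cdots a_m\to a_{m+1}\cdots a_{m+n}$ (reflexivity relations implicit). $\mathcal{I}$ is the class of inclusions $\emptyset\to G$ and $G^{m+n}\to R^{m,n}$ for $m,n\in\mathbb{N}$. -}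

module Defs where

open import Data.Empty using (⊥)
open import Data.Unit using (⊤)
open import Data.Nat using (ℕ; _+_)
open import Data.Fin using (Fin; _↑ˡ_; _↑ʳ_)
open import Data.List using (List; map; allFin)
open import Data.Product using (Σ; ∃; _×_)
open import Data.Sum using (_⊎_)
open import Relation.Binary.PropositionalEquality using (_≡_)

-- A reflexive presentation of a monoid: a set of generators P₁ and a
-- relation P₂ ⊆ P₁* × P₁* (words = lists) containing u → u for every word u.
record RPres : Set₁ where
  field
    Gen   : Set
    Rel   : List Gen → List Gen → Set
    refl→ : ∀ u → Rel u u
open RPres public

record Hom (P Q : RPres) : Set where
  field
    fun  : Gen P → Gen Q
    pres : ∀ u v → Rel P u v → Rel Q (map fun u) (map fun v)
open Hom public

-- Lifting problem / right lifting property of f : P → Q against i : A → B.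
-- Equality of morphisms is equality of the underlying generator functions.
RLP : {A B P Q : RPres} → Hom A B → Hom P Q → Set
RLP {A} {B} {P} {Q} i f =
  (g : Hom A P) (h : Hom B Q) →
  (∀ x → fun f (fun g x) ≡ fun h (fun i x)) →
  Σ (Hom B P) λ l →
    (∀ x → fun l (fun i x) ≡ fun g x) × (∀ x → fun f (fun l x) ≡ fun h x)

Empty : RPres
Empty = record { Gen = ⊥ ; Rel = _≡_ ; refl→ = λ u → Relation.Binary.PropositionalEquality.refl }
  where import Relation.Binary.PropositionalEquality

G : RPres
G = record { Gen = ⊤ ; Rel = _≡_ ; refl→ = λ u → Relation.Binary.PropositionalEquality.refl }
  where import Relation.Binary.PropositionalEquality

Gⁿ : ℕ → RPres
Gⁿ n = record { Gen = Fin n ; Rel = _≡_ ; refl→ = λ u → Relation.Binary.PropositionalEquality.refl }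
  where import Relation.Binary.PropositionalEquality

-- The words a₁⋯aₘ and aₘ₊₁⋯aₘ₊ₙ in the generators Fin (m + n).
leftWord : (m n : ℕ) → List (Fin (m + n))
leftWord m n = map (λ i → i ↑ˡ n) (allFin m)

rightWord : (m n : ℕ) → List (Fin (m + n))
rightWord m n = map (λ j → m ↑ʳ j) (allFin n)

-- R^{m,n} : generators a₁ … a_{m+n}, relation a₁⋯aₘ → aₘ₊₁⋯aₘ₊ₙ (plus reflexivity).
RelR : (m n : ℕ) → List (Fin (m + n)) → List (Fin (m + n)) → Set
RelR m n u v = (u ≡ v) ⊎ ((u ≡ leftWord m n) × (v ≡ rightWord m n))

R : ℕ → ℕ → RPres
R m n = record { Gen = Fin (m + n) ; Rel = RelR m n
               ; refl→ = λ u → Data.Sum.inj₁ Relation.Binary.PropositionalEquality.refl }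
  where import Relation.Binary.PropositionalEquality
        import Data.Sum

ι₀ : Hom Empty G
ι₀ = record { fun = λ () ; pres = λ u v p → Relation.Binary.PropositionalEquality.cong (map (λ ())) p }
  where import Relation.Binary.PropositionalEquality

ι : (m n : ℕ) → Hom (Gⁿ (m + n)) (R m n)
ι m n = record { fun = λ x → x
               ; pres = λ u v p → Data.Sum.inj₁ (Relation.Binary.PropositionalEquality.cong (map (λ x → x)) p) }
  where import Relation.Binary.PropositionalEquality
        import Data.Sum

-- Trivial fibration: right lifting property w.r.t. every morphism of 𝓘.
TrivialFibration : {P Q : RPres} → Hom P Q → Set
TrivialFibration f = RLP ι₀ f × (∀ m n → RLP (ι m n) f)

Surjective : {A B : Set} → (A → B) → Set
Surjective {A} {B} f = ∀ (b : B) → ∃ λ (a : A) → f a ≡ b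

ReflectsRel : {P Q : RPres} → Hom P Q → Set
ReflectsRel {P} {Q} f = ∀ u v → Rel Q (map (fun f) u) (map (fun f) v) → Rel P u v

-- A lift against ∅ → G is a preimage of one generator, so lifting against it
-- is surjectivity.  A lift against G^{m+n} → R^{m,n} is forced to be the
-- given map on generators, and it is a morphism exactly when the single
-- relation a₁⋯aₘ → aₘ₊₁⋯aₘ₊ₙ is sent into P₂; since f*(u) → f*(v) in Q₂ can
-- be presented as the image of that relation under the map R^{|u|,|v|} → Q
-- spelling u and v, this is reflection of relations.
module Submission where

open import Defs
open import Data.Product using (_×_; _,_; proj₁; proj₂)
open import Data.Sum using (inj₁; inj₂; [_,_])
open import Data.Unit using (tt)
open import Data.Nat using (_+_)
open import Data.Fin using (Fin; _↑ˡ_; _↑ʳ_; splitAt)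
open import Data.Fin.Properties using (splitAt-↑ˡ; splitAt-↑ʳ)
open import Data.List using (List; map; length; lookup; allFin)
open import Data.List.Properties using (map-cong; map-∘; map-tabulate; tabulate-lookup)
open import Function using (_∘_)
open import Function.Bundles using (_⇔_; mk⇔)
open import Relation.Binary.PropositionalEquality
  using (_≡_; refl; sym; trans; cong; subst₂; module ≡-Reasoning)

map-respects-≡ : {X : Set} (P : RPres) (k : X → Gen P) →
                 ∀ u v → u ≡ v → Rel P (map k u) (map k v)
map-respects-≡ P k u .u refl = refl→ P (map k u)

map-lookup-allFin : {A : Set} (u : List A) → map (lookup u) (allFin (length u)) ≡ u
map-lookup-allFin u = trans (map-tabulate (λ i → i) (lookup u)) (tabulate-lookup u)

map-comp-pres : {P Q : RPres} (f : Hom P Q) {X : Set} (k : X → Gen P) (h : X → Gen Q) →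
                (∀ x → fun f (k x) ≡ h x) → ∀ w → map (fun f) (map k w) ≡ map h w
map-comp-pres f k h comm w = trans (sym (map-∘ w)) (map-cong comm w)

module _ {A : Set} (u v : List A) where

  private
    m = length u
    n = length v

  spell : Fin (m + n) → A
  spell i = [ lookup u , lookup v ] (splitAt m i)

  map-spell-leftWord : map spell (leftWord m n) ≡ u
  map-spell-leftWord = begin
    map spell (map (_↑ˡ n) (allFin m))  ≡⟨ map-∘ (allFin m) ⟨
    map (spell ∘ (_↑ˡ n)) (allFin m)     ≡⟨ map-cong (λ i → cong [ lookup u , lookup v ] (splitAt-↑ˡ m i n)) (allFin m) ⟩
    map (lookup u) (allFin m)            ≡⟨ map-lookup-allFin u ⟩
    u                                    ∎
    where open ≡-Reasoning

  map-spell-rightWord : map spell (rightWord m n) ≡ v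
  map-spell-rightWord = begin
    map spell (map (m ↑ʳ_) (allFin n))  ≡⟨ map-∘ (allFin n) ⟨
    map (spell ∘ (m ↑ʳ_)) (allFin n)     ≡⟨ map-cong (λ i → cong [ lookup u , lookup v ] (splitAt-↑ʳ m n i)) (allFin n) ⟩
    map (lookup v) (allFin n)            ≡⟨ map-lookup-allFin v ⟩
    v                                    ∎
    where open ≡-Reasoning

module _ {P Q : RPres} (f : Hom P Q) where

  surjective⇒RLP-ι₀ : Surjective (fun f) → RLP ι₀ f
  surjective⇒RLP-ι₀ surj g h _ = l , (λ ()) , (λ x → proj₂ (surj (fun h x)))
    where
    l : Hom G P
    l = record { fun = λ x → proj₁ (surj (fun h x)) ; pres = map-respects-≡ P _ }

  RLP-ι₀⇒surjective : RLP ι₀ f → Surjective (fun f)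
  RLP-ι₀⇒surjective lift b = fun (proj₁ solution) tt , proj₂ (proj₂ solution) tt
    where
    point : Hom G Q
    point = record { fun = λ _ → b ; pres = map-respects-≡ Q _ }

    empty : Hom Empty P
    empty = record { fun = λ () ; pres = map-respects-≡ P _ }

    solution = lift empty point (λ ())

  reflectsRel⇒RLP-ι : ReflectsRel f → ∀ m n → RLP (ι m n) f
  reflectsRel⇒RLP-ι reflects m n g h comm = l , (λ _ → refl) , comm
    where
    image = map-comp-pres f (fun g) (fun h) comm

    l : Hom (R m n) P
    l = record
      { fun  = fun g
      ; pres = λ u v r → reflects (map (fun g) u) (map (fun g) v)
                           (subst₂ (Rel Q) (sym (image u)) (sym (image v)) (pres h u v r))
      }

  RLP-ι⇒reflectsRel : (∀ m n → RLP (ι m n) f) → ReflectsRel f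
  RLP-ι⇒reflectsRel lift u v fu→fv =
    subst₂ (Rel P) (lifted u (map-spell-leftWord u v)) (lifted v (map-spell-rightWord u v))
           (pres l _ _ (inj₂ (refl , refl)))
    where
    m = length u
    n = length v

    free : Hom (Gⁿ (m + n)) P
    free = record { fun = spell u v ; pres = map-respects-≡ P _ }

    image : ∀ w → map (fun f) (map (spell u v) w) ≡ map (fun f ∘ spell u v) w
    image = map-comp-pres f (spell u v) (fun f ∘ spell u v) (λ _ → refl)

    spellImage-pres : ∀ a b → RelR m n a b →
                      Rel Q (map (fun f ∘ spell u v) a) (map (fun f ∘ spell u v) b)
    spellImage-pres a b (inj₁ a≡b)          = map-respects-≡ Q _ a b a≡b
    spellImage-pres _ _ (inj₂ (refl , refl)) =
      subst₂ (Rel Q)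
        (trans (cong (map (fun f)) (sym (map-spell-leftWord u v))) (image (leftWord m n)))
        (trans (cong (map (fun f)) (sym (map-spell-rightWord u v))) (image (rightWord m n)))
        fu→fv

    spellImage : Hom (R m n) Q
    spellImage = record { fun = fun f ∘ spell u v ; pres = spellImage-pres }

    solution = lift m n free spellImage (λ _ → refl)
    l = proj₁ solution

    lifted : ∀ {w} x → map (spell u v) w ≡ x → map (fun l) w ≡ x
    lifted {w} _ spelled = trans (map-cong (proj₁ (proj₂ solution)) w) spelled

mainTheorem14 : {P Q : RPres} (f : Hom P Q) →
    TrivialFibration f ⇔ (Surjective (fun f) × ReflectsRel f)
mainTheorem14 f = mk⇔
  (λ (lift₀ , liftR) → RLP-ι₀⇒surjective f lift₀ , RLP-ι⇒reflectsRel f liftR)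
  (λ (surj , reflects) → surjective⇒RLP-ι₀ f surj , reflectsRel⇒RLP-ι f reflects)
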